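{- Let $b\ge2$, $d\ge1$, and let $a_1,\dots,a_d$ be positive integers coprime to $b$. Then for every $t\in\mathbb{Z}$, \[S_{(a_1,\dots,a_d;b)}(t)=\frac{(-1)^d}{b^d}\left[\sum_{\substack{1\le k_1,\dots,k_d\le b-1\\ a_1k_1+\cdots+a_dk_d\equiv -t\ (\mathrm{mod}\ b)}}k_1k_2\cdots k_d\;-\;\frac1b\binom{b}{2}^d\right].\]
   Context: $\xi_b=e^{2\pi i/b}$ and $S_{(a_1,\dots,a_d;b)}(n)=\frac1b\sum_{j=1}^{b-1}\frac{\xi_b^{jn}}{(1-\xi_b^{ja_1})\cdots(1-\xi_b^{ja_d})}$. -}

module Defs where

open import Level using (Level; _⊔_) renaming (suc to lsuc)
open import Data.Nat as ℕ using (ℕ; zero; suc)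
open import Data.Nat.Divisibility using (_∣?_)
open import Data.Integer as ℤ using (ℤ; +_; -[1+_]; ∣_∣)
open import Data.List using (List; []; _∷_; map; upTo; concatMap; foldr)
open import Data.Vec using (Vec; []; _∷_)
open import Data.Bool using (if_then_else_)
open import Relation.Nullary using (¬_; does)
open import Relation.Binary.PropositionalEquality using (_≡_)
open import Data.Product using (_×_)
open import Algebra.Bundles using (CommutativeRing)

module RingDefs {c ℓ : Level} (R : CommutativeRing c ℓ) where
  open CommutativeRing R

  pow : Carrier → ℕ → Carrier
  pow x zero    = 1#
  pow x (suc n) = x * pow x n

  ι : ℕ → Carrier
  ι zero    = 0#
  ι (suc n) = 1# + ι n

  sumL : List Carrier → Carrier
  sumL = foldr _+_ 0#

  prodV : ∀ {d} → Vec Carrier d → Carrier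
  prodV []       = 1#
  prodV (x ∷ xs) = x * prodV xs

  mapV : ∀ {d} → (ℕ → Carrier) → Vec ℕ d → Vec Carrier d
  mapV f []       = []
  mapV f (x ∷ xs) = f x ∷ mapV f xs

  IsPrimitiveRoot : Carrier → ℕ → Set ℓ
  IsPrimitiveRoot ξ b = (pow ξ b ≈ 1#) × (∀ k → 1 ℕ.≤ k → k ℕ.< b → ¬ (pow ξ k ≈ 1#))

-- A field of characteristic zero, presented as a commutative ring with a
-- (total) inverse operation that is a genuine inverse on nonzero elements,
-- and such that n·1 = 0 only for n = 0.
record CharZeroField (c ℓ : Level) : Set (lsuc (c ⊔ ℓ)) where
  field
    cring    : CommutativeRing c ℓ
  open CommutativeRing cring using (Carrier; _≈_; _*_; 0#; 1#)
  field
    _⁻¹      : Carrier → Carrier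
    inverse  : ∀ x → ¬ (x ≈ 0#) → (x * (x ⁻¹)) ≈ 1#
    charZero : ∀ n → RingDefs.ι cring n ≈ 0# → n ≡ 0

module FieldDefs {c ℓ : Level} (F : CharZeroField c ℓ) where
  open CharZeroField F public
  open CommutativeRing cring public
  open RingDefs cring public

  zpow : Carrier → ℤ → Carrier
  zpow x (+ n)     = pow x n
  zpow x -[1+ n ]  = pow (x ⁻¹) (suc n)

  range1 : ℕ → List ℕ
  range1 b = map suc (upTo (b ℕ.∸ 1))

  -- S_{(a_1,…,a_d; b)}(t) computed with the primitive b-th root of unity ξ:
  -- (1/b) Σ_{j=1}^{b-1} ξ^{jt} / Π_i (1 - ξ^{j a_i})
  S : ∀ {d} → Vec ℕ d → (b : ℕ) → (ξ : Carrier) → ℤ → Carrier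
  S a b ξ t =
    (ι b) ⁻¹ * sumL (map (λ j → zpow ξ ((+ j) ℤ.* t)
                               * (prodV (mapV (λ ai → 1# - pow ξ (j ℕ.* ai)) a)) ⁻¹)
                          (range1 b))

tuples : (d b : ℕ) → List (Vec ℕ d)
tuples zero    b = [] ∷ []
tuples (suc d) b = concatMap (λ k → map (k ∷_) (tuples d b)) (map suc (upTo (b ℕ.∸ 1)))

dotV : ∀ {d} → Vec ℕ d → Vec ℕ d → ℕ
dotV []       []       = 0
dotV (a ∷ as) (k ∷ ks) = a ℕ.* k ℕ.+ dotV as ks

prodℕ : ∀ {d} → Vec ℕ d → ℕ
prodℕ []       = 1
prodℕ (k ∷ ks) = k ℕ.* prodℕ ks

-- Σ_{1 ≤ k_i ≤ b-1, a·k ≡ -t (mod b)} k_1 ⋯ k_d   (a·k ≡ -t mod b  ⇔  b ∣ a·k + t)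
congSum : ∀ {d} → Vec ℕ d → (b : ℕ) → ℤ → ℕ
congSum {d} a b t =
  foldr (λ k acc → if does (b ∣? ∣ (+ dotV a k) ℤ.+ t ∣) then prodℕ k ℕ.+ acc else acc)
        0 (tuples d b)

-- For a b-th root of unity ω ≠ 1, telescoping gives (1 - ω) Σ_{k=1}^{b-1} k ω^k = -b.  Since the
-- a_i are prime to b, ξ^{j a_i} ≠ 1 for 0 < j < b, so each factor 1/(1 - ξ^{j a_i}) of S expands
-- as -(1/b) Σ_k k ξ^{j a_i k}, and the j-th summand of S becomes
-- (-b)^{-d} Σ_{k ∈ [1,b-1]^d} k_1⋯k_d ξ^{j(a·k + t)}.  Exchanging the sums over j and k, the
-- inner sum Σ_{j=1}^{b-1} η^j of an η with η^b = 1 is b - 1 or -1 according as η = 1 or not,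
-- i.e. as b ∣ a·k + t or not; what remains is (Σ_{k=1}^{b-1} k)^d = C(b,2)^d.
module Submission where

open import Defs
open import Level using (Level)
open import Algebra.Bundles using (CommutativeRing)
import Algebra.Solver.Ring.AlmostCommutativeRing as ACR
open import Data.Bool using (Bool; true; false; if_then_else_)
open import Data.Fin as Fin using (Fin)
open import Data.List using (List; []; _∷_; _++_; [_]; map; upTo; concatMap; foldr)
open import Data.List.Properties using (map-∘; map-cong; map-upTo; upTo-∷ʳ)
open import Data.Maybe using (just; nothing)
open import Data.Nat as ℕ using (ℕ; zero; suc; _≤_; _<_; s≤s; z≤n)
import Data.Nat.Properties as ℕP
open import Data.Nat.Combinatorics using (_C_; nC1≡n; nCk+nC[k+1]≡[n+1]C[k+1])
open import Data.Nat.Coprimality as Coprimality using (Coprime)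
open import Data.Nat.Divisibility as Div using (_∣_; divides; _∣?_)
open import Data.Nat.DivMod using (_%_; _/_; m≡m%n+[m/n]*n; m%n<n)
open import Data.Integer as ℤ using (ℤ; +_; -[1+_]; _⊖_)
import Data.Integer.Properties as ℤP
import Data.Sign as Sign
open import Data.Product using (_×_; proj₁; proj₂)
open import Data.Vec using (Vec; []; _∷_; lookup)
open import Data.Empty using (⊥-elim)
open import Function using (_∘_)
open import Relation.Nullary using (¬_; Dec; does; yes; no)
open import Relation.Binary.Definitions using (WeaklyDecidable)
open import Relation.Binary.PropositionalEquality as P using (_≡_)

module CommutativeRingLemmas {c ℓ : Level} (R : CommutativeRing c ℓ) where
  open CommutativeRing R hiding (zero)
  open RingDefs R
  open import Algebra.Properties.Ring ring
    using (-0#≈0#; -‿involutive; -‿+-comm; -‿distribˡ-*; -‿distribʳ-*)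
  open import Algebra.Properties.CommutativeSemigroup +-commutativeSemigroup
    using () renaming (interchange to +-interchange)
  open import Algebra.Properties.CommutativeSemigroup *-commutativeSemigroup
    using () renaming (interchange to *-interchange)
  open import Algebra.Properties.Semiring.Exp semiring using (_^_; ^-homo-*; ^-assocʳ)
  open import Algebra.Properties.CommutativeSemiring.Exp commutativeSemiring using (^-distrib-*)
  open import Relation.Binary.Reasoning.Setoid setoid

  ι-homo-+ : ∀ m n → ι (m ℕ.+ n) ≈ ι m + ι n
  ι-homo-+ zero n = sym (+-identityˡ _)
  ι-homo-+ (suc m) n = trans (+-congˡ (ι-homo-+ m n)) (sym (+-assoc _ _ _))

  ι-homo-* : ∀ m n → ι (m ℕ.* n) ≈ ι m * ι n
  ι-homo-* zero n = sym (zeroˡ _)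
  ι-homo-* (suc m) n = begin
    ι (n ℕ.+ m ℕ.* n)        ≈⟨ ι-homo-+ n (m ℕ.* n) ⟩
    ι n + ι (m ℕ.* n)        ≈⟨ +-cong (sym (*-identityˡ _)) (ι-homo-* m n) ⟩
    1# * ι n + ι m * ι n     ≈⟨ distribʳ _ _ _ ⟨
    (1# + ι m) * ι n         ∎

  pow≡^ : ∀ x n → pow x n ≡ x ^ n
  pow≡^ x zero    = P.refl
  pow≡^ x (suc n) = P.cong (x *_) (pow≡^ x n)

  pow-cong : ∀ {x y} n → x ≈ y → pow x n ≈ pow y n
  pow-cong zero    x≈y = refl
  pow-cong (suc n) x≈y = *-cong x≈y (pow-cong n x≈y)

  pow-homo-+ : ∀ x m n → pow x (m ℕ.+ n) ≈ pow x m * pow x n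
  pow-homo-+ x m n rewrite pow≡^ x (m ℕ.+ n) | pow≡^ x m | pow≡^ x n = ^-homo-* x m n

  pow-assoc : ∀ x m n → pow (pow x m) n ≈ pow x (m ℕ.* n)
  pow-assoc x m n rewrite pow≡^ x m | pow≡^ (x ^ m) n | pow≡^ x (m ℕ.* n) = ^-assocʳ x m n

  pow-distrib-* : ∀ x y n → pow (x * y) n ≈ pow x n * pow y n
  pow-distrib-* x y n rewrite pow≡^ (x * y) n | pow≡^ x n | pow≡^ y n = ^-distrib-* x y n

  pow-comm : ∀ x m n → pow (pow x m) n ≈ pow (pow x n) m
  pow-comm x m n = begin
    pow (pow x m) n   ≈⟨ pow-assoc x m n ⟩
    pow x (m ℕ.* n)   ≡⟨ P.cong (pow x) (ℕP.*-comm m n) ⟩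
    pow x (n ℕ.* m)   ≈⟨ pow-assoc x n m ⟨
    pow (pow x n) m   ∎

  pow-1# : ∀ n → pow 1# n ≈ 1#
  pow-1# zero    = refl
  pow-1# (suc n) = trans (*-identityˡ _) (pow-1# n)

  pow-pow≈1 : ∀ x b → pow x b ≈ 1# → ∀ m → pow (pow x m) b ≈ 1#
  pow-pow≈1 x b xᵇ≈1 m = trans (pow-comm x m b) (trans (pow-cong m xᵇ≈1) (pow-1# m))

  module IntegerSolver where
    ℤ→R : ℤ → Carrier
    ℤ→R (+ n)    = ι n
    ℤ→R -[1+ n ] = - ι (suc n)

    ℤ→R-homo-‿ : ∀ i → ℤ→R (ℤ.- i) ≈ - ℤ→R i
    ℤ→R-homo-‿ (+ zero)  = sym -0#≈0#
    ℤ→R-homo-‿ (+ suc n) = refl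
    ℤ→R-homo-‿ -[1+ n ]  = sym (-‿involutive _)

    ℤ→R-homo-⊖ : ∀ m n → ℤ→R (m ⊖ n) ≈ ι m - ι n
    ℤ→R-homo-⊖ zero    zero    = sym (-‿inverseʳ 0#)
    ℤ→R-homo-⊖ zero    (suc n) = sym (+-identityˡ _)
    ℤ→R-homo-⊖ (suc m) zero    = sym (trans (+-congˡ -0#≈0#) (+-identityʳ _))
    ℤ→R-homo-⊖ (suc m) (suc n) = begin
      ℤ→R (suc m ⊖ suc n)             ≡⟨ P.cong ℤ→R (ℤP.[1+m]⊖[1+n]≡m⊖n m n) ⟩
      ℤ→R (m ⊖ n)                     ≈⟨ ℤ→R-homo-⊖ m n ⟩
      ι m - ι n                     ≈⟨ +-identityˡ _ ⟨
      0# + (ι m - ι n)              ≈⟨ +-congʳ (-‿inverseʳ 1#) ⟨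
      (1# - 1#) + (ι m - ι n)       ≈⟨ +-interchange _ _ _ _ ⟩
      (1# + ι m) + (- 1# + - ι n)   ≈⟨ +-congˡ (-‿+-comm 1# (ι n)) ⟩
      ι (suc m) - ι (suc n)         ∎

    ℤ→R-homo-+ : ∀ i j → ℤ→R (i ℤ.+ j) ≈ ℤ→R i + ℤ→R j
    ℤ→R-homo-+ (+ m)    (+ n)    = ι-homo-+ m n
    ℤ→R-homo-+ (+ m)    -[1+ n ] = ℤ→R-homo-⊖ m (suc n)
    ℤ→R-homo-+ -[1+ m ] (+ n)    = trans (ℤ→R-homo-⊖ n (suc m)) (+-comm _ _)
    ℤ→R-homo-+ -[1+ m ] -[1+ n ] = begin
      - ι (suc (suc (m ℕ.+ n)))     ≡⟨ P.cong (-_ ∘ ι ∘ suc) (P.sym (ℕP.+-suc m n)) ⟩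
      - ι (suc m ℕ.+ suc n)         ≈⟨ -‿cong (ι-homo-+ (suc m) (suc n)) ⟩
      - (ι (suc m) + ι (suc n))     ≈⟨ -‿+-comm _ _ ⟨
      - ι (suc m) + - ι (suc n)     ∎

    ℤ→R-homo-*-+ : ∀ m j → ℤ→R (+ m ℤ.* j) ≈ ι m * ℤ→R j
    ℤ→R-homo-*-+ m (+ n)    = trans (reflexive (P.cong ℤ→R (P.sym (ℤP.pos-* m n)))) (ι-homo-* m n)
    ℤ→R-homo-*-+ m -[1+ n ] = begin
      ℤ→R (+ m ℤ.* -[1+ n ])          ≡⟨ P.cong ℤ→R (ℤP.neg-distribʳ-* (+ m) (+ suc n)) ⟨
      ℤ→R (ℤ.- (+ m ℤ.* + suc n))     ≈⟨ ℤ→R-homo-‿ (+ m ℤ.* + suc n) ⟩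
      - ℤ→R (+ m ℤ.* + suc n)         ≈⟨ -‿cong (ℤ→R-homo-*-+ m (+ suc n)) ⟩
      - (ι m * ι (suc n))           ≈⟨ -‿distribʳ-* _ _ ⟩
      ι m * - ι (suc n)             ∎

    ℤ→R-homo-* : ∀ i j → ℤ→R (i ℤ.* j) ≈ ℤ→R i * ℤ→R j
    ℤ→R-homo-* (+ m)    j = ℤ→R-homo-*-+ m j
    ℤ→R-homo-* -[1+ m ] j = begin
      ℤ→R (-[1+ m ] ℤ.* j)            ≡⟨ P.cong ℤ→R (ℤP.neg-distribˡ-* (+ suc m) j) ⟨
      ℤ→R (ℤ.- (+ suc m ℤ.* j))       ≈⟨ ℤ→R-homo-‿ (+ suc m ℤ.* j) ⟩
      - ℤ→R (+ suc m ℤ.* j)           ≈⟨ -‿cong (ℤ→R-homo-*-+ (suc m) j) ⟩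
      - (ι (suc m) * ℤ→R j)         ≈⟨ -‿distribˡ-* _ _ ⟩
      - ι (suc m) * ℤ→R j           ∎

    -- The solver states its goals through ⟦_⟧, which therefore sends + 1 to 1# on the nose.
    ι′ : ℕ → Carrier
    ι′ 0             = 0#
    ι′ 1             = 1#
    ι′ (suc (suc n)) = 1# + ι′ (suc n)

    ι′≈ι : ∀ n → ι′ n ≈ ι n
    ι′≈ι 0             = refl
    ι′≈ι 1             = sym (+-identityʳ 1#)
    ι′≈ι (suc (suc n)) = +-congˡ (ι′≈ι (suc n))

    ⟦_⟧ : ℤ → Carrier
    ⟦ + n ⟧      = ι′ n
    ⟦ -[1+ n ] ⟧ = - ι′ (suc n)

    ⟦⟧≈ℤ→R : ∀ i → ⟦ i ⟧ ≈ ℤ→R i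
    ⟦⟧≈ℤ→R (+ n)    = ι′≈ι n
    ⟦⟧≈ℤ→R -[1+ n ] = -‿cong (ι′≈ι (suc n))

    ℤ⟶R : ℤ.+-*-rawRing ACR.-Raw-AlmostCommutative⟶ ACR.fromCommutativeRing R
    ℤ⟶R = record
      { ⟦_⟧    = ⟦_⟧
      ; +-homo = λ i j → via-ℤ→R (i ℤ.+ j) (ℤ→R-homo-+ i j) (+-cong (⟦⟧≈ℤ→R i) (⟦⟧≈ℤ→R j))
      ; *-homo = λ i j → via-ℤ→R (i ℤ.* j) (ℤ→R-homo-* i j) (*-cong (⟦⟧≈ℤ→R i) (⟦⟧≈ℤ→R j))
      ; -‿homo = λ i → via-ℤ→R (ℤ.- i) (ℤ→R-homo-‿ i) (-‿cong (⟦⟧≈ℤ→R i))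
      ; 0-homo = refl
      ; 1-homo = refl
      }
      where
      via-ℤ→R : ∀ {x y} k → ℤ→R k ≈ x → y ≈ x → ⟦ k ⟧ ≈ y
      via-ℤ→R k k≈x y≈x = trans (⟦⟧≈ℤ→R k) (trans k≈x (sym y≈x))

    ℤ-≟ : WeaklyDecidable (ACR.Induced-equivalence ℤ⟶R)
    ℤ-≟ i j with i ℤ.≟ j
    ... | yes P.refl = just refl
    ... | no _       = nothing

    open import Algebra.Solver.Ring ℤ.+-*-rawRing (ACR.fromCommutativeRing R) ℤ⟶R ℤ-≟ public
      using (Polynomial; solve; _:=_; _:+_; _:*_; :-_; _:-_; con)

    :0 :1 : ∀ {n} → Polynomial n
    :0 = con (+ 0)
    :1 = con (+ 1)

  open IntegerSolver public using (solve; _:=_; _:+_; _:*_; :-_; _:-_; :0; :1)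

  infix 5 ∑
  ∑ : ∀ {A : Set} → List A → (A → Carrier) → Carrier
  ∑ xs f = sumL (map f xs)

  syntax ∑ xs (λ x → e) = ∑[ x ∈ xs ] e

  ∑-cong : ∀ {A : Set} (xs : List A) {f g : A → Carrier} → (∀ x → f x ≈ g x) → ∑ xs f ≈ ∑ xs g
  ∑-cong []       f≈g = refl
  ∑-cong (x ∷ xs) f≈g = +-cong (f≈g x) (∑-cong xs f≈g)

  ∑-map : ∀ {A B : Set} (h : A → B) (xs : List A) (f : B → Carrier) → ∑ (map h xs) f ≡ ∑ xs (f ∘ h)
  ∑-map h xs f = P.cong sumL (P.sym (map-∘ xs))

  ∑-++ : ∀ {A : Set} (xs ys : List A) (f : A → Carrier) → ∑ (xs ++ ys) f ≈ ∑ xs f + ∑ ys f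
  ∑-++ []       ys f = sym (+-identityˡ _)
  ∑-++ (x ∷ xs) ys f = trans (+-congˡ (∑-++ xs ys f)) (sym (+-assoc _ _ _))

  ∑-concatMap : ∀ {A B : Set} (h : A → List B) (xs : List A) (f : B → Carrier) →
                ∑ (concatMap h xs) f ≈ ∑[ x ∈ xs ] ∑ (h x) f
  ∑-concatMap h []       f = refl
  ∑-concatMap h (x ∷ xs) f = trans (∑-++ (h x) (concatMap h xs) f) (+-congˡ (∑-concatMap h xs f))

  ∑-0# : ∀ {A : Set} (xs : List A) → ∑[ x ∈ xs ] 0# ≈ 0#
  ∑-0# []       = refl
  ∑-0# (x ∷ xs) = trans (+-identityˡ _) (∑-0# xs)

  ∑-distrib-+ : ∀ {A : Set} (xs : List A) (f g : A → Carrier) →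
                ∑[ x ∈ xs ] (f x + g x) ≈ ∑ xs f + ∑ xs g
  ∑-distrib-+ []       f g = sym (+-identityʳ _)
  ∑-distrib-+ (x ∷ xs) f g = trans (+-congˡ (∑-distrib-+ xs f g)) (+-interchange _ _ _ _)

  ∑-distrib-- : ∀ {A : Set} (xs : List A) (f g : A → Carrier) →
                ∑[ x ∈ xs ] (f x - g x) ≈ ∑ xs f - ∑ xs g
  ∑-distrib-- xs f g =
    trans (∑-distrib-+ xs f (-_ ∘ g)) (+-congˡ (∑-neg xs))
    where
    ∑-neg : ∀ ys → ∑[ y ∈ ys ] - g y ≈ - ∑ ys g
    ∑-neg []       = sym -0#≈0#
    ∑-neg (y ∷ ys) = trans (+-congˡ (∑-neg ys)) (-‿+-comm _ _)

  *-distribˡ-∑ : ∀ {A : Set} (xs : List A) a (f : A → Carrier) → a * ∑ xs f ≈ ∑[ x ∈ xs ] a * f x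
  *-distribˡ-∑ []       a f = zeroʳ a
  *-distribˡ-∑ (x ∷ xs) a f = trans (distribˡ _ _ _) (+-congˡ (*-distribˡ-∑ xs a f))

  *-distribʳ-∑ : ∀ {A : Set} (xs : List A) a (f : A → Carrier) → ∑ xs f * a ≈ ∑[ x ∈ xs ] f x * a
  *-distribʳ-∑ xs a f =
    trans (*-comm _ _) (trans (*-distribˡ-∑ xs a f) (∑-cong xs (λ x → *-comm a (f x))))

  ∑-comm : ∀ {A B : Set} (xs : List A) (ys : List B) (f : A → B → Carrier) →
           ∑[ x ∈ xs ] ∑[ y ∈ ys ] f x y ≈ ∑[ y ∈ ys ] ∑[ x ∈ xs ] f x y
  ∑-comm []       ys f = sym (∑-0# ys)
  ∑-comm (x ∷ xs) ys f =
    trans (+-congˡ (∑-comm xs ys f)) (sym (∑-distrib-+ ys (f x) (λ y → ∑[ x′ ∈ xs ] f x′ y)))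

  ∑-upTo-∷ʳ : ∀ n (f : ℕ → Carrier) → ∑ (upTo (suc n)) f ≈ ∑ (upTo n) f + f n
  ∑-upTo-∷ʳ n f = begin
    ∑ (upTo (suc n)) f          ≡⟨ P.cong (λ xs → ∑ xs f) (upTo-∷ʳ n) ⟨
    ∑ (upTo n ++ [ n ]) f       ≈⟨ ∑-++ (upTo n) [ n ] f ⟩
    ∑ (upTo n) f + (f n + 0#)   ≈⟨ +-congˡ (+-identityʳ _) ⟩
    ∑ (upTo n) f + f n          ∎

  ∑-upTo-∷ : ∀ n (f : ℕ → Carrier) → ∑ (upTo (suc n)) f ≡ f 0 + ∑ (map suc (upTo n)) f
  ∑-upTo-∷ n f = P.cong (λ xs → f 0 + ∑ xs f) (P.sym (map-upTo suc n))

  ∑-upTo-cong : ∀ n {f g : ℕ → Carrier} → (∀ k → k < n → f k ≈ g k) → ∑ (upTo n) f ≈ ∑ (upTo n) g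
  ∑-upTo-cong zero    f≈g = refl
  ∑-upTo-cong (suc n) {f} {g} f≈g = begin
    ∑ (upTo (suc n)) f   ≈⟨ ∑-upTo-∷ʳ n f ⟩
    ∑ (upTo n) f + f n   ≈⟨ +-cong (∑-upTo-cong n (λ k k<n → f≈g k (ℕP.m<n⇒m<1+n k<n)))
                                   (f≈g n (ℕP.n<1+n n)) ⟩
    ∑ (upTo n) g + g n   ≈⟨ ∑-upTo-∷ʳ n g ⟨
    ∑ (upTo (suc n)) g   ∎

  ∑-upTo-1# : ∀ n → ∑[ k ∈ upTo n ] 1# ≈ ι n
  ∑-upTo-1# zero    = refl
  ∑-upTo-1# (suc n) = trans (∑-upTo-∷ʳ n _) (trans (+-comm _ _) (+-congˡ (∑-upTo-1# n)))

  ∑-upTo-ι-suc : ∀ n → ∑[ k ∈ upTo n ] ι (suc k) ≈ ι (suc n C 2)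
  ∑-upTo-ι-suc zero    = refl
  ∑-upTo-ι-suc (suc n) = begin
    ∑[ k ∈ upTo (suc n) ] ι (suc k)           ≈⟨ ∑-upTo-∷ʳ n (ι ∘ suc) ⟩
    (∑[ k ∈ upTo n ] ι (suc k)) + ι (suc n)   ≈⟨ +-cong (∑-upTo-ι-suc n) (reflexive (P.cong ι (P.sym (nC1≡n (suc n))))) ⟩
    ι (suc n C 2) + ι (suc n C 1)             ≈⟨ +-comm _ _ ⟩
    ι (suc n C 1) + ι (suc n C 2)             ≈⟨ ι-homo-+ (suc n C 1) (suc n C 2) ⟨
    ι (suc n C 1 ℕ.+ suc n C 2)               ≡⟨ P.cong ι (nCk+nC[k+1]≡[n+1]C[k+1] (suc n) 1) ⟩
    ι (suc (suc n) C 2)                       ∎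

  ι-foldr-if : ∀ {A : Set} (xs : List A) (β : A → Bool) (p : A → ℕ) →
               ι (foldr (λ x acc → if β x then p x ℕ.+ acc else acc) 0 xs)
                 ≈ ∑[ x ∈ xs ] (if β x then ι (p x) else 0#)
  ι-foldr-if []       β p = refl
  ι-foldr-if (x ∷ xs) β p with β x
  ... | true  = trans (ι-homo-+ (p x) _) (+-congˡ (ι-foldr-if xs β p))
  ... | false = trans (ι-foldr-if xs β p) (sym (+-identityˡ _))

  p[if-B-1]≈B[if-p]-p : ∀ (β : Bool) p B → p * ((if β then B else 0#) - 1#) ≈ B * (if β then p else 0#) - p
  p[if-B-1]≈B[if-p]-p true  = solve 2 (λ p B → p :* (B :- :1) := B :* p :- p) refl
  p[if-B-1]≈B[if-p]-p false = solve 2 (λ p B → p :* (:0 :- :1) := B :* :0 :- p) refl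

  ∑-pow-1 : ∀ {w} n → w ≈ 1# → ∑ (upTo n) (pow w) ≈ ι n
  ∑-pow-1 n w≈1 = trans (∑-cong (upTo n) (λ k → trans (pow-cong k w≈1) (pow-1# k))) (∑-upTo-1# n)

  geometric-telescope : ∀ w n → (1# - w) * ∑ (upTo n) (pow w) ≈ 1# - pow w n
  geometric-telescope w zero    = trans (zeroʳ _) (sym (-‿inverseʳ 1#))
  geometric-telescope w (suc n) = begin
    (1# - w) * ∑ (upTo (suc n)) (pow w)                  ≈⟨ *-congˡ (∑-upTo-∷ʳ n (pow w)) ⟩
    (1# - w) * (∑ (upTo n) (pow w) + pow w n)            ≈⟨ distribˡ _ _ _ ⟩
    (1# - w) * ∑ (upTo n) (pow w) + (1# - w) * pow w n   ≈⟨ +-congʳ (geometric-telescope w n) ⟩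
    (1# - pow w n) + (1# - w) * pow w n
      ≈⟨ solve 2 (λ w u → (:1 :- u) :+ (:1 :- w) :* u := :1 :- w :* u) refl w (pow w n) ⟩
    1# - w * pow w n                                     ∎

  weighted-geometric-telescope : ∀ w n →
    (1# - w) * (∑[ k ∈ upTo n ] ι (suc k) * pow w (suc k))
      ≈ (∑[ k ∈ upTo n ] pow w (suc k)) - ι n * pow w (suc n)
  weighted-geometric-telescope w zero = begin
    (1# - w) * 0#             ≈⟨ zeroʳ _ ⟩
    0#                        ≈⟨ solve 1 (λ u → :0 := :0 :- :0 :* u) refl (pow w 1) ⟩
    0# - 0# * pow w 1         ∎
  weighted-geometric-telescope w (suc n) = begin
    (1# - w) * ∑ (upTo (suc n)) g                   ≈⟨ *-congˡ (∑-upTo-∷ʳ n g) ⟩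
    (1# - w) * (∑ (upTo n) g + g n)                 ≈⟨ distribˡ _ _ _ ⟩
    (1# - w) * ∑ (upTo n) g + (1# - w) * g n        ≈⟨ +-congʳ (weighted-geometric-telescope w n) ⟩
    (∑ (upTo n) h - ι n * u) + (1# - w) * ((1# + ι n) * u)
      ≈⟨ solve 4 (λ s v u w → (s :- v :* u) :+ (:1 :- w) :* ((:1 :+ v) :* u)
                               := (s :+ u) :- (:1 :+ v) :* (w :* u))
               refl (∑ (upTo n) h) (ι n) u w ⟩
    (∑ (upTo n) h + h n) - ι (suc n) * pow w (suc (suc n))   ≈⟨ +-congʳ (∑-upTo-∷ʳ n h) ⟨
    ∑ (upTo (suc n)) h - ι (suc n) * pow w (suc (suc n))     ∎
    where
    g h : ℕ → Carrier
    g k = ι (suc k) * pow w (suc k)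
    h k = pow w (suc k)
    u = pow w (suc n)

  prodV-distrib-* : ∀ {d} (f g : ℕ → Carrier) (a : Vec ℕ d) →
                    prodV (mapV f a) * prodV (mapV g a) ≈ prodV (mapV (λ x → f x * g x) a)
  prodV-distrib-* f g []      = *-identityˡ 1#
  prodV-distrib-* f g (x ∷ a) = trans (*-interchange _ _ _ _) (*-congˡ (prodV-distrib-* f g a))

  prodV-const : ∀ {d} (f : ℕ → Carrier) k (a : Vec ℕ d) → (∀ i → f (lookup a i) ≈ k) →
                prodV (mapV f a) ≈ pow k d
  prodV-const f k []      f≈k = refl
  prodV-const f k (x ∷ a) f≈k = *-cong (f≈k Fin.zero) (prodV-const f k a (f≈k ∘ Fin.suc))

  weightedPowerSum : ℕ → Carrier → ℕ → Carrier
  weightedPowerSum b ω a = ∑[ k ∈ map suc (upTo (b ℕ.∸ 1)) ] ι k * pow ω (a ℕ.* k)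

  tupleSum : ∀ {d} → Vec ℕ d → ℕ → Carrier → Carrier
  tupleSum {d} a b ω = ∑[ k ∈ tuples d b ] ι (prodℕ k) * pow ω (dotV a k)

  prodV-weightedPowerSum : ∀ {d} b ω (a : Vec ℕ d) →
                           prodV (mapV (weightedPowerSum b ω) a) ≈ tupleSum a b ω
  prodV-weightedPowerSum b ω []               = sym (trans (+-identityʳ _) (trans (*-identityʳ _) (+-identityʳ _)))
  prodV-weightedPowerSum {suc d} b ω (ai ∷ a) = begin
    ∑ K A * prodV (mapV (weightedPowerSum b ω) a)  ≈⟨ *-congˡ (prodV-weightedPowerSum b ω a) ⟩
    ∑ K A * ∑ T B                                  ≈⟨ *-distribʳ-∑ K _ A ⟩
    ∑[ k ∈ K ] A k * ∑ T B                         ≈⟨ ∑-cong K (λ k → *-distribˡ-∑ T (A k) B) ⟩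
    ∑[ k ∈ K ] ∑[ ks ∈ T ] A k * B ks              ≈⟨ ∑-cong K (λ k → ∑-cong T (λ ks → sym (split k ks))) ⟩
    ∑[ k ∈ K ] ∑[ ks ∈ T ] G (k ∷ ks)              ≡⟨ P.cong sumL (map-cong (λ k → P.sym (∑-map (k ∷_) T G)) K) ⟩
    ∑[ k ∈ K ] ∑ (map (k ∷_) T) G                  ≈⟨ ∑-concatMap (λ k → map (k ∷_) T) K G ⟨
    tupleSum (ai ∷ a) b ω                          ∎
    where
    K : List ℕ
    K = map suc (upTo (b ℕ.∸ 1))
    T : List (Vec ℕ d)
    T = tuples d b
    A : ℕ → Carrier
    A k = ι k * pow ω (ai ℕ.* k)
    B : Vec ℕ d → Carrier
    B ks = ι (prodℕ ks) * pow ω (dotV a ks)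
    G : Vec ℕ (suc d) → Carrier
    G ks = ι (prodℕ ks) * pow ω (dotV (ai ∷ a) ks)
    split : ∀ k ks → G (k ∷ ks) ≈ A k * B ks
    split k ks = trans (*-cong (ι-homo-* k (prodℕ ks)) (pow-homo-+ ω (ai ℕ.* k) (dotV a ks)))
                       (*-interchange _ _ _ _)

  tupleSum-1# : ∀ {d} n (a : Vec ℕ d) → tupleSum a (suc n) 1# ≈ pow (ι (suc n C 2)) d
  tupleSum-1# {d} n a = begin
    tupleSum a (suc n) 1#                          ≈⟨ prodV-weightedPowerSum (suc n) 1# a ⟨
    prodV (mapV (weightedPowerSum (suc n) 1#) a)   ≈⟨ prodV-const _ _ a (λ i → weightedPowerSum-1# (lookup a i)) ⟩
    pow (ι (suc n C 2)) d                          ∎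
    where
    weightedPowerSum-1# : ∀ ai → weightedPowerSum (suc n) 1# ai ≈ ι (suc n C 2)
    weightedPowerSum-1# ai = begin
      ∑[ k ∈ map suc (upTo n) ] ι k * pow 1# (ai ℕ.* k)   ≡⟨ ∑-map suc (upTo n) _ ⟩
      ∑[ k ∈ upTo n ] ι (suc k) * pow 1# (ai ℕ.* suc k)
        ≈⟨ ∑-cong (upTo n) (λ k → trans (*-congˡ (pow-1# (ai ℕ.* suc k))) (*-identityʳ _)) ⟩
      ∑[ k ∈ upTo n ] ι (suc k)                          ≈⟨ ∑-upTo-ι-suc n ⟩
      ι (suc n C 2)                                      ∎

module CharZeroFieldLemmas {c ℓ : Level} (F : CharZeroField c ℓ) where
  open FieldDefs F hiding (zero)
  open CommutativeRingLemmas cring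
  open import Algebra.Properties.Ring ring
    using (-‿involutive; -1*x≈-x; x∙y⁻¹≈ε⇒x≈y; xyx⁻¹≈y; +-inverseʳ-unique)
  open import Algebra.Properties.CommutativeSemigroup *-commutativeSemigroup
    using (interchange; x∙yz≈y∙xz; x∙yz≈xz∙y)
  open import Relation.Binary.Reasoning.Setoid setoid

  ι[1+n]≉0 : ∀ n → ¬ ι (suc n) ≈ 0#
  ι[1+n]≉0 n ι≈0 with charZero (suc n) ι≈0
  ... | ()

  1#≉0# : ¬ 1# ≈ 0#
  1#≉0# 1≈0 = ι[1+n]≉0 0 (trans (+-identityʳ 1#) 1≈0)

  x≉0∧xy≈0⇒y≈0 : ∀ {x y} → ¬ x ≈ 0# → x * y ≈ 0# → y ≈ 0#
  x≉0∧xy≈0⇒y≈0 {x} {y} x≉0 xy≈0 = begin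
    y                ≈⟨ *-identityˡ y ⟨
    1# * y           ≈⟨ *-congʳ (trans (*-comm _ _) (inverse x x≉0)) ⟨
    (x ⁻¹ * x) * y   ≈⟨ *-assoc _ _ _ ⟩
    x ⁻¹ * (x * y)   ≈⟨ *-congˡ xy≈0 ⟩
    x ⁻¹ * 0#        ≈⟨ zeroʳ _ ⟩
    0#               ∎

  pow-≉0 : ∀ {x} n → ¬ x ≈ 0# → ¬ pow x n ≈ 0#
  pow-≉0 zero    x≉0        = 1#≉0#
  pow-≉0 (suc n) x≉0 xⁿ⁺¹≈0 = pow-≉0 n x≉0 (x≉0∧xy≈0⇒y≈0 x≉0 xⁿ⁺¹≈0)

  ⁻¹-unique : ∀ {x y} → x * y ≈ 1# → x ⁻¹ ≈ y
  ⁻¹-unique {x} {y} xy≈1 = begin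
    x ⁻¹             ≈⟨ *-identityʳ _ ⟨
    x ⁻¹ * 1#        ≈⟨ *-congˡ xy≈1 ⟨
    x ⁻¹ * (x * y)   ≈⟨ *-assoc _ _ _ ⟨
    (x ⁻¹ * x) * y   ≈⟨ *-congʳ (trans (*-comm _ _) (inverse x x≉0)) ⟩
    1# * y           ≈⟨ *-identityˡ y ⟩
    y                ∎
    where
    x≉0 : ¬ x ≈ 0#
    x≉0 x≈0 = 1#≉0# (trans (sym xy≈1) (trans (*-congʳ x≈0) (zeroˡ y)))

  xy≈1∧x≈1⇒y≈1 : ∀ {x y} → x * y ≈ 1# → x ≈ 1# → y ≈ 1#
  xy≈1∧x≈1⇒y≈1 {x} {y} xy≈1 x≈1 = trans (sym (*-identityˡ y)) (trans (*-congʳ (sym x≈1)) xy≈1)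

  ∑-pow-root-of-unity : ∀ {w} n → pow w n ≈ 1# → ¬ w ≈ 1# → ∑ (upTo n) (pow w) ≈ 0#
  ∑-pow-root-of-unity {w} n wⁿ≈1 w≉1 = x≉0∧xy≈0⇒y≈0 1-w≉0 (begin
    (1# - w) * ∑ (upTo n) (pow w)   ≈⟨ geometric-telescope w n ⟩
    1# - pow w n                    ≈⟨ +-congˡ (-‿cong wⁿ≈1) ⟩
    1# - 1#                         ≈⟨ -‿inverseʳ 1# ⟩
    0#                              ∎)
    where
    1-w≉0 : ¬ 1# - w ≈ 0#
    1-w≉0 1-w≈0 = w≉1 (sym (x∙y⁻¹≈ε⇒x≈y 1# w 1-w≈0))

  weighted-∑-pow-root-of-unity : ∀ {w} n → pow w (suc n) ≈ 1# → ¬ w ≈ 1# →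
    (1# - w) * (∑[ k ∈ upTo n ] ι (suc k) * pow w (suc k)) ≈ - ι (suc n)
  weighted-∑-pow-root-of-unity {w} n wⁿ⁺¹≈1 w≉1 = begin
    (1# - w) * (∑[ k ∈ upTo n ] ι (suc k) * pow w (suc k))   ≈⟨ weighted-geometric-telescope w n ⟩
    (∑[ k ∈ upTo n ] pow w (suc k)) - ι n * pow w (suc n)     ≈⟨ +-cong H≈-1 (-‿cong (*-congˡ wⁿ⁺¹≈1)) ⟩
    - 1# - ι n * 1#
      ≈⟨ solve 1 (λ v → :- :1 :- v :* :1 := :- (:1 :+ v)) refl (ι n) ⟩
    - ι (suc n)                                               ∎
    where
    H≈-1 : ∑[ k ∈ upTo n ] pow w (suc k) ≈ - 1#
    H≈-1 = +-inverseʳ-unique 1# _ (begin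
      1# + (∑[ k ∈ upTo n ] pow w (suc k))  ≡⟨ P.cong (_+_ 1#) (∑-map suc (upTo n) (pow w)) ⟨
      1# + ∑ (map suc (upTo n)) (pow w)     ≡⟨ ∑-upTo-∷ n (pow w) ⟨
      ∑ (upTo (suc n)) (pow w)              ≈⟨ ∑-pow-root-of-unity (suc n) wⁿ⁺¹≈1 w≉1 ⟩
      0#                                    ∎)

  zpow-suc : ∀ {x} → x * x ⁻¹ ≈ 1# → ∀ z → zpow x (ℤ.suc z) ≈ x * zpow x z
  zpow-suc     xx⁻¹≈1 (+ n)          = refl
  zpow-suc     xx⁻¹≈1 -[1+ zero ]    = sym (trans (*-congˡ (*-identityʳ _)) xx⁻¹≈1)
  zpow-suc {x} xx⁻¹≈1 -[1+ suc k ] = sym (begin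
    x * (x ⁻¹ * pow (x ⁻¹) (suc k))   ≈⟨ *-assoc _ _ _ ⟨
    (x * x ⁻¹) * pow (x ⁻¹) (suc k)   ≈⟨ *-congʳ xx⁻¹≈1 ⟩
    1# * pow (x ⁻¹) (suc k)           ≈⟨ *-identityˡ _ ⟩
    pow (x ⁻¹) (suc k)                ∎)

  zpow-+ : ∀ {x} → x * x ⁻¹ ≈ 1# → ∀ n z → zpow x (+ n ℤ.+ z) ≈ pow x n * zpow x z
  zpow-+ {x} xx⁻¹≈1 zero    z = trans (reflexive (P.cong (zpow x) (ℤP.+-identityˡ z))) (sym (*-identityˡ _))
  zpow-+ {x} xx⁻¹≈1 (suc n) z = begin
    zpow x (+ suc n ℤ.+ z)       ≡⟨ P.cong (zpow x) (ℤP.suc-+ n z) ⟩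
    zpow x (ℤ.suc (+ n ℤ.+ z))   ≈⟨ zpow-suc xx⁻¹≈1 (+ n ℤ.+ z) ⟩
    x * zpow x (+ n ℤ.+ z)       ≈⟨ *-congˡ (zpow-+ xx⁻¹≈1 n z) ⟩
    x * (pow x n * zpow x z)     ≈⟨ *-assoc _ _ _ ⟨
    pow x (suc n) * zpow x z     ∎

  zpow-* : ∀ x j z → zpow x (+ j ℤ.* z) ≈ pow (zpow x z) j
  zpow-* x j (+ n)    = begin
    zpow x (+ j ℤ.* + n)   ≡⟨ P.cong (zpow x) (ℤP.pos-* j n) ⟨
    pow x (j ℕ.* n)        ≡⟨ P.cong (pow x) (ℕP.*-comm j n) ⟩
    pow x (n ℕ.* j)        ≈⟨ pow-assoc x n j ⟨
    pow (pow x n) j        ∎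
  zpow-* x j -[1+ n ] = begin
    zpow x (Sign.- ℤ.◃ (j ℕ.* suc n))   ≈⟨ zpow-◃ (j ℕ.* suc n) ⟩
    pow (x ⁻¹) (j ℕ.* suc n)            ≡⟨ P.cong (pow (x ⁻¹)) (ℕP.*-comm j (suc n)) ⟩
    pow (x ⁻¹) (suc n ℕ.* j)            ≈⟨ pow-assoc (x ⁻¹) (suc n) j ⟨
    pow (pow (x ⁻¹) (suc n)) j          ∎
    where
    zpow-◃ : ∀ N → zpow x (Sign.- ℤ.◃ N) ≈ pow (x ⁻¹) N
    zpow-◃ zero    = refl
    zpow-◃ (suc N) = refl

  module PrimitiveRoot (n : ℕ) (ξ : Carrier) (prim : IsPrimitiveRoot ξ (suc n)) where
    b : ℕ
    b = suc n

    ξᵇ≈1 : pow ξ b ≈ 1#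
    ξᵇ≈1 = proj₁ prim

    ∣⇒ξ^≈1 : ∀ {N} → b ∣ N → pow ξ N ≈ 1#
    ∣⇒ξ^≈1 (divides q P.refl) = begin
      pow ξ (q ℕ.* b)    ≡⟨ P.cong (pow ξ) (ℕP.*-comm q b) ⟩
      pow ξ (b ℕ.* q)    ≈⟨ pow-assoc ξ b q ⟨
      pow (pow ξ b) q    ≈⟨ pow-cong q ξᵇ≈1 ⟩
      pow 1# q           ≈⟨ pow-1# q ⟩
      1#                 ∎

    -- ξ^(N mod b) = ξ^N = 1, so N mod b = 0 by primitivity.
    ξ^≈1⇒∣ : ∀ N → pow ξ N ≈ 1# → b ∣ N
    ξ^≈1⇒∣ N ξᴺ≈1 with N % b in N%b≡r
    ... | zero  = Div.m%n≡0⇒n∣m N b N%b≡r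
    ... | suc r = ⊥-elim (proj₂ prim (suc r) (s≤s z≤n) r<b (begin
      pow ξ (suc r)                         ≡⟨ P.cong (pow ξ) N%b≡r ⟨
      pow ξ (N % b)                         ≈⟨ *-identityʳ _ ⟨
      pow ξ (N % b) * 1#                    ≈⟨ *-congˡ (∣⇒ξ^≈1 (Div.n∣m*n (N / b))) ⟨
      pow ξ (N % b) * pow ξ (N / b ℕ.* b)   ≈⟨ pow-homo-+ ξ (N % b) (N / b ℕ.* b) ⟨
      pow ξ (N % b ℕ.+ N / b ℕ.* b)         ≡⟨ P.cong (pow ξ) (m≡m%n+[m/n]*n N b) ⟨
      pow ξ N                               ≈⟨ ξᴺ≈1 ⟩
      1#                                    ∎))
      where
      r<b : suc r < b
      r<b = P.subst (_< b) N%b≡r (m%n<n N b)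

    ξξ⁻¹≈1 : ξ * ξ ⁻¹ ≈ 1#
    ξξ⁻¹≈1 = inverse ξ (λ ξ≈0 → 1#≉0# (trans (sym ξᵇ≈1) (trans (*-congʳ ξ≈0) (zeroˡ _))))

    ξ^ξ⁻¹^≈1 : ∀ N → pow ξ N * pow (ξ ⁻¹) N ≈ 1#
    ξ^ξ⁻¹^≈1 N = trans (sym (pow-distrib-* ξ (ξ ⁻¹) N)) (trans (pow-cong N ξξ⁻¹≈1) (pow-1# N))

    ∣⇒zpow≈1 : ∀ z → b ∣ ℤ.∣ z ∣ → zpow ξ z ≈ 1#
    ∣⇒zpow≈1 (+ N)    b∣N = ∣⇒ξ^≈1 b∣N
    ∣⇒zpow≈1 -[1+ N ] b∣N = xy≈1∧x≈1⇒y≈1 (ξ^ξ⁻¹^≈1 (suc N)) (∣⇒ξ^≈1 b∣N)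

    zpow≈1⇒∣ : ∀ z → zpow ξ z ≈ 1# → b ∣ ℤ.∣ z ∣
    zpow≈1⇒∣ (+ N)        = ξ^≈1⇒∣ N
    zpow≈1⇒∣ -[1+ N ] e = ξ^≈1⇒∣ (suc N) (xy≈1∧x≈1⇒y≈1 (trans (*-comm _ _) (ξ^ξ⁻¹^≈1 (suc N))) e)

    zpowᵇ≈1 : ∀ z → pow (zpow ξ z) b ≈ 1#
    zpowᵇ≈1 (+ N)    = pow-pow≈1 ξ b ξᵇ≈1 N
    zpowᵇ≈1 -[1+ N ] = pow-pow≈1 (ξ ⁻¹) b (xy≈1∧x≈1⇒y≈1 (ξ^ξ⁻¹^≈1 b) ξᵇ≈1) (suc N)

    ∑-zpow : ∀ z → ∑[ j ∈ map suc (upTo n) ] pow (zpow ξ z) j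
                     ≈ (if does (b ∣? ℤ.∣ z ∣) then ι b else 0#) - 1#
    ∑-zpow z = begin
      ∑ (map suc (upTo n)) (pow η)                    ≈⟨ xyx⁻¹≈y 1# _ ⟨
      1# + ∑ (map suc (upTo n)) (pow η) - 1#          ≡⟨ P.cong (_- 1#) (∑-upTo-∷ n (pow η)) ⟨
      ∑ (upTo b) (pow η) - 1#                         ≈⟨ +-congʳ (∑-upTo-b (b ∣? ℤ.∣ z ∣)) ⟩
      (if does (b ∣? ℤ.∣ z ∣) then ι b else 0#) - 1#  ∎
      where
      η = zpow ξ z
      ∑-upTo-b : (b∣? : Dec (b ∣ ℤ.∣ z ∣)) → ∑ (upTo b) (pow η) ≈ (if does b∣? then ι b else 0#)
      ∑-upTo-b (yes b∣z) = ∑-pow-1 b (∣⇒zpow≈1 z b∣z)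
      ∑-upTo-b (no b∤z)  = ∑-pow-root-of-unity b (zpowᵇ≈1 z) (b∤z ∘ zpow≈1⇒∣ z)

    ξ^[j*a]≉1 : ∀ {j ai} → suc j < b → Coprime ai b → ¬ pow ξ (suc j ℕ.* ai) ≈ 1#
    ξ^[j*a]≉1 {j} {ai} j<b ai⊥b ξʲᵃ≈1 = ℕP.<⇒≱ j<b (Div.∣⇒≤ b∣j)
      where
      b∣j : b ∣ suc j
      b∣j = Coprimality.coprime-divisor (Coprimality.sym ai⊥b)
              (P.subst (b ∣_) (ℕP.*-comm (suc j) ai) (ξ^≈1⇒∣ _ ξʲᵃ≈1))

    module _ {d} (a : Vec ℕ d) (coprime : ∀ i → Coprime (lookup a i) b) (t : ℤ) where
      P : ℕ → Carrier
      P j = prodV (mapV (λ ai → 1# - pow ξ (j ℕ.* ai)) a)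

      κ : Carrier
      κ = pow (- 1#) d * (pow (ι b) d) ⁻¹

      [-b]ᵈ*κ≈1 : pow (- ι b) d * κ ≈ 1#
      [-b]ᵈ*κ≈1 = begin
        pow (- ι b) d * κ                                      ≈⟨ *-congʳ (pow-cong d (-1*x≈-x (ι b))) ⟨
        pow (- 1# * ι b) d * κ                                 ≈⟨ *-congʳ (pow-distrib-* (- 1#) (ι b) d) ⟩
        (pow (- 1#) d * pow (ι b) d) * κ                       ≈⟨ interchange _ _ _ _ ⟩
        (pow (- 1#) d * pow (- 1#) d) * (bᵈ * bᵈ ⁻¹)           ≈⟨ *-cong (sym (pow-distrib-* (- 1#) (- 1#) d)) (inverse bᵈ bᵈ≉0) ⟩
        pow (- 1# * - 1#) d * 1#                               ≈⟨ *-congʳ (pow-cong d (trans (-1*x≈-x (- 1#)) (-‿involutive 1#))) ⟩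
        pow 1# d * 1#                                          ≈⟨ *-congʳ (pow-1# d) ⟩
        1# * 1#                                                ≈⟨ *-identityʳ 1# ⟩
        1#                                                     ∎
        where
        bᵈ = pow (ι b) d
        bᵈ≉0 : ¬ bᵈ ≈ 0#
        bᵈ≉0 = pow-≉0 d (ι[1+n]≉0 n)

      factor-weightedPowerSum : ∀ {j} → suc j < b → ∀ ai → Coprime ai b →
        (1# - pow ξ (suc j ℕ.* ai)) * weightedPowerSum b (pow ξ (suc j)) ai ≈ - ι b
      factor-weightedPowerSum {j} j<b ai ai⊥b = begin
        (1# - pow ξ (suc j ℕ.* ai)) * (∑[ k ∈ map suc (upTo n) ] ι k * pow ω (ai ℕ.* k))
          ≈⟨ *-cong (+-congˡ (-‿cong (sym (pow-assoc ξ (suc j) ai)))) (reflexive (∑-map suc (upTo n) _)) ⟩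
        (1# - w) * (∑[ k ∈ upTo n ] ι (suc k) * pow ω (ai ℕ.* suc k))
          ≈⟨ *-congˡ (∑-cong (upTo n) (λ k → *-congˡ (sym (pow-assoc ω ai (suc k))))) ⟩
        (1# - w) * (∑[ k ∈ upTo n ] ι (suc k) * pow w (suc k))
          ≈⟨ weighted-∑-pow-root-of-unity n (pow-pow≈1 ω b (pow-pow≈1 ξ b ξᵇ≈1 (suc j)) ai) w≉1 ⟩
        - ι b  ∎
        where
        ω = pow ξ (suc j)
        w = pow ω ai
        w≉1 : ¬ w ≈ 1#
        w≉1 w≈1 = ξ^[j*a]≉1 j<b ai⊥b (trans (sym (pow-assoc ξ (suc j) ai)) w≈1)

      P*tupleSum≈[-b]ᵈ : ∀ {j} → suc j < b → P (suc j) * tupleSum a b (pow ξ (suc j)) ≈ pow (- ι b) d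
      P*tupleSum≈[-b]ᵈ {j} j<b = begin
        P (suc j) * tupleSum a b ω                               ≈⟨ *-congˡ (prodV-weightedPowerSum b ω a) ⟨
        P (suc j) * prodV (mapV (weightedPowerSum b ω) a)        ≈⟨ prodV-distrib-* _ _ a ⟩
        prodV (mapV (λ ai → (1# - pow ξ (suc j ℕ.* ai)) * weightedPowerSum b ω ai) a)
          ≈⟨ prodV-const _ _ a (λ i → factor-weightedPowerSum j<b (lookup a i) (coprime i)) ⟩
        pow (- ι b) d                                            ∎
        where
        ω = pow ξ (suc j)

      P⁻¹≈κ*tupleSum : ∀ {j} → suc j < b → P (suc j) ⁻¹ ≈ κ * tupleSum a b (pow ξ (suc j))
      P⁻¹≈κ*tupleSum {j} j<b = ⁻¹-unique (begin
        P (suc j) * (κ * tupleSum a b (pow ξ (suc j)))   ≈⟨ x∙yz≈xz∙y _ _ _ ⟩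
        (P (suc j) * tupleSum a b (pow ξ (suc j))) * κ   ≈⟨ *-congʳ (P*tupleSum≈[-b]ᵈ j<b) ⟩
        pow (- ι b) d * κ                                ≈⟨ [-b]ᵈ*κ≈1 ⟩
        1#                                               ∎)

      T : List (Vec ℕ d)
      T = tuples d b

      η : Vec ℕ d → Carrier
      η k = zpow ξ (+ dotV a k ℤ.+ t)

      W : ℕ → Carrier
      W j = ∑[ k ∈ T ] ι (prodℕ k) * pow (η k) j

      S-summand : ∀ {j} → suc j < b → zpow ξ (+ suc j ℤ.* t) * P (suc j) ⁻¹ ≈ κ * W (suc j)
      S-summand {j} j<b = begin
        x * P (suc j) ⁻¹                                       ≈⟨ *-congˡ (P⁻¹≈κ*tupleSum j<b) ⟩
        x * (κ * tupleSum a b ω)                               ≈⟨ x∙yz≈y∙xz _ _ _ ⟩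
        κ * (x * tupleSum a b ω)                               ≈⟨ *-congˡ (*-distribˡ-∑ T x _) ⟩
        κ * (∑[ k ∈ T ] x * (ι (prodℕ k) * pow ω (dotV a k)))  ≈⟨ *-congˡ (∑-cong T (λ k → x∙yz≈y∙xz _ _ _)) ⟩
        κ * (∑[ k ∈ T ] ι (prodℕ k) * (x * pow ω (dotV a k)))  ≈⟨ *-congˡ (∑-cong T (λ k → *-congˡ (shift (dotV a k)))) ⟩
        κ * W (suc j)                                          ∎
        where
        x = zpow ξ (+ suc j ℤ.* t)
        ω = pow ξ (suc j)
        shift : ∀ D → x * pow ω D ≈ pow (zpow ξ (+ D ℤ.+ t)) (suc j)
        shift D = begin
          x * pow ω D                                     ≈⟨ *-cong (zpow-* ξ (suc j) t) (pow-comm ξ (suc j) D) ⟩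
          pow (zpow ξ t) (suc j) * pow (pow ξ D) (suc j)  ≈⟨ pow-distrib-* _ _ (suc j) ⟨
          pow (zpow ξ t * pow ξ D) (suc j)                ≈⟨ pow-cong (suc j) (trans (*-comm _ _) (sym (zpow-+ ξξ⁻¹≈1 D t))) ⟩
          pow (zpow ξ (+ D ℤ.+ t)) (suc j)                ∎

      X Y : Carrier
      X = ι (congSum a b t)
      Y = pow (ι (b C 2)) d

      ∑W≈bX-Y : ∑ (map suc (upTo n)) W ≈ ι b * X - Y
      ∑W≈bX-Y = begin
        ∑[ j ∈ J ] ∑[ k ∈ T ] ι (prodℕ k) * pow (η k) j         ≈⟨ ∑-comm J T _ ⟩
        ∑[ k ∈ T ] ∑[ j ∈ J ] ι (prodℕ k) * pow (η k) j         ≈⟨ ∑-cong T (λ k → *-distribˡ-∑ J _ _) ⟨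
        ∑[ k ∈ T ] ι (prodℕ k) * ∑ J (pow (η k))                ≈⟨ ∑-cong T (λ k → *-congˡ (∑-zpow (+ dotV a k ℤ.+ t))) ⟩
        ∑[ k ∈ T ] ι (prodℕ k) * ((if β k then ι b else 0#) - 1#)
          ≈⟨ ∑-cong T (λ k → p[if-B-1]≈B[if-p]-p (β k) _ _) ⟩
        ∑[ k ∈ T ] (ι b * (if β k then ι (prodℕ k) else 0#) - ι (prodℕ k))
          ≈⟨ ∑-distrib-- T _ _ ⟩
        (∑[ k ∈ T ] ι b * (if β k then ι (prodℕ k) else 0#)) - (∑[ k ∈ T ] ι (prodℕ k))
          ≈⟨ +-cong (*-distribˡ-∑ T (ι b) _) (-‿cong (∑-cong T λ k → *-identityʳ _)) ⟨
        ι b * (∑[ k ∈ T ] (if β k then ι (prodℕ k) else 0#)) - (∑[ k ∈ T ] ι (prodℕ k) * 1#)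
          ≈⟨ +-cong (*-congˡ (ι-foldr-if T β prodℕ)) (-‿cong (∑-cong T λ k → *-congˡ (pow-1# (dotV a k)))) ⟨
        ι b * X - tupleSum a b 1#                                ≈⟨ +-congˡ (-‿cong (tupleSum-1# n a)) ⟩
        ι b * X - Y                                              ∎
        where
        J = map suc (upTo n)
        β : Vec ℕ d → Bool
        β k = does (b ∣? ℤ.∣ + dotV a k ℤ.+ t ∣)

      S≈ : S a b ξ t ≈ κ * (X - (ι b) ⁻¹ * Y)
      S≈ = begin
        b⁻¹ * ∑ (map suc (upTo n)) f                  ≡⟨ P.cong (b⁻¹ *_) (∑-map suc (upTo n) f) ⟩
        b⁻¹ * (∑[ j ∈ upTo n ] f (suc j))             ≈⟨ *-congˡ (∑-upTo-cong n (λ j j<n → S-summand (s≤s j<n))) ⟩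
        b⁻¹ * (∑[ j ∈ upTo n ] κ * W (suc j))         ≈⟨ *-congˡ (*-distribˡ-∑ (upTo n) κ (W ∘ suc)) ⟨
        b⁻¹ * (κ * ∑ (upTo n) (W ∘ suc))              ≡⟨ P.cong (λ s → b⁻¹ * (κ * s)) (∑-map suc (upTo n) W) ⟨
        b⁻¹ * (κ * ∑ (map suc (upTo n)) W)            ≈⟨ *-congˡ (*-congˡ ∑W≈bX-Y) ⟩
        b⁻¹ * (κ * (ι b * X - Y))
          ≈⟨ solve 5 (λ b⁻¹ κ B X Y → b⁻¹ :* (κ :* (B :* X :- Y)) := κ :* ((B :* b⁻¹) :* X :- b⁻¹ :* Y))
                   refl b⁻¹ κ (ι b) X Y ⟩
        κ * ((ι b * b⁻¹) * X - b⁻¹ * Y)               ≈⟨ *-congˡ (+-congʳ (*-congʳ (inverse (ι b) (ι[1+n]≉0 n)))) ⟩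
        κ * (1# * X - b⁻¹ * Y)                        ≈⟨ *-congˡ (+-congʳ (*-identityˡ X)) ⟩
        κ * (X - b⁻¹ * Y)                             ∎
        where
        b⁻¹ = (ι b) ⁻¹
        f : ℕ → Carrier
        f j = zpow ξ (+ j ℤ.* t) * P j ⁻¹

corollary16 : ∀ {c ℓ : Level} (F : CharZeroField c ℓ) → let open FieldDefs F in
    (b d : ℕ) → 2 ≤ b → 1 ≤ d →
    (a : Vec ℕ d) → (∀ (i : Fin d) → (1 ≤ lookup a i) × Coprime (lookup a i) b) →
    (ξ : Carrier) → IsPrimitiveRoot ξ b →
    (t : ℤ) →
    S a b ξ t ≈ (pow (- 1#) d * (pow (ι b) d) ⁻¹)
    * (ι (congSum a b t) - (ι b) ⁻¹ * pow (ι (b C 2)) d)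
corollary16 F zero    d ()
corollary16 F (suc n) d _  _ a hyp ξ prim t =
  CharZeroFieldLemmas.PrimitiveRoot.S≈ F n ξ prim a (proj₂ ∘ hyp) t
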